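{- Let $\mathbb{D}$ be a bilinear DHO of rank $n$ with ambient space of dimension $n+r$ over $\mathbb{F}_2$. The right nucleus of the DHO-set associated with $\mathbb{D}$ is $\mathbb{F}_2$.
   Context: A dimensional dual hyperoval (DHO) of rank $n\ge 2$ in an $(n+r)$-dimensional $\mathbb{F}_2$-space $U$ is a collection $\mathbb{D}$ of $n$-dimensional subspaces such that any two distinct members meet in a $1$-dimensional subspace, any three distinct members meet only in $\{\mathbf 0\}$, and $\#\mathbb{D}=2^n$; its ambient space is the span of its members. $\mathbb{D}$ splits over an $r$-dimensional subspace $Y$ if $U=X\oplus Y$ for all $X\in\mathbb{D}$; then, for a fixed member $X$, there is an injective map $\beta:X\to\mathrm{Hom}(X,Y)\cong\mathbb{F}_2^{n\times r}$ with $\mathbb{D}=\{\{(\mathbf x,\mathbf x\beta(\mathbf a)):\mathbf x\in X\}:\mathbf a\in X\}$, and the DHO-set associated with $\mathbb{D}$ is $\mathcal D=\{\beta(\mathbf a):\mathbf a\in X\}$. $\mathbb{D}$ is bilinear if $\beta$ is $\mathbb{F}_2$-linear, so $\mathcal D$ is an $\mathbb{F}_2$-linear code in $\mathbb{F}_2^{n\times r}$. The right nucleus of a linear code $\mathcal C\subseteq\mathbb{F}_2^{n\times r}$ is $N_r(\mathcal C)=\{Y\in\mathbb{F}_2^{r\times r}: CY\in\mathcal C\text{ for all }C\in\mathcal C\}$. -}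

module Defs where

open import Data.Bool using (Bool; true; false; _xor_; _∧_)
open import Data.Nat using (ℕ; zero; suc)
open import Data.Fin using (Fin; _≟_) renaming (zero to fzero; suc to fsuc)
open import Data.Product using (Σ; ∃; _×_; _,_)
open import Data.Sum using (_⊎_)
open import Relation.Nullary using (¬_; does)
open import Relation.Binary.PropositionalEquality using (_≡_)

-- The field 𝔽₂ is modelled by Bool with addition _xor_ and multiplication _∧_.

-- Vectors in 𝔽₂^n and n×r matrices over 𝔽₂ (row vectors act on the left: x ↦ x M).
Vec₂ : ℕ → Set
Vec₂ n = Fin n → Bool

Mat₂ : ℕ → ℕ → Set
Mat₂ n r = Fin n → Fin r → Bool

sum₂ : {n : ℕ} → (Fin n → Bool) → Bool
sum₂ {zero}  f = false
sum₂ {suc n} f = f fzero xor sum₂ (λ i → f (fsuc i))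

_+ᵥ_ : {n : ℕ} → Vec₂ n → Vec₂ n → Vec₂ n
(x +ᵥ y) i = x i xor y i

_≈ᵥ_ : {n : ℕ} → Vec₂ n → Vec₂ n → Set
x ≈ᵥ y = ∀ i → x i ≡ y i

IsZeroᵥ : {n : ℕ} → Vec₂ n → Set
IsZeroᵥ x = ∀ i → x i ≡ false

_·ᵥₘ_ : {n r : ℕ} → Vec₂ n → Mat₂ n r → Vec₂ r
(x ·ᵥₘ M) j = sum₂ (λ i → x i ∧ M i j)

_·ₘ_ : {n r s : ℕ} → Mat₂ n r → Mat₂ r s → Mat₂ n s
(A ·ₘ B) i k = sum₂ (λ j → A i j ∧ B j k)

_≈ₘ_ : {n r : ℕ} → Mat₂ n r → Mat₂ n r → Set
A ≈ₘ B = ∀ i j → A i j ≡ B i j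

scalarMat : (r : ℕ) → Bool → Mat₂ r r
scalarMat r c i j = c ∧ does (i ≟ j)

-- The ambient space U = X ⊕ Y = 𝔽₂^n ⊕ 𝔽₂^r, elements are pairs (x , y).

U₂ : ℕ → ℕ → Set
U₂ n r = Vec₂ n × Vec₂ r

_+ᵤ_ : {n r : ℕ} → U₂ n r → U₂ n r → U₂ n r
(x , y) +ᵤ (x' , y') = (x +ᵥ x') , (y +ᵥ y')

_≈ᵤ_ : {n r : ℕ} → U₂ n r → U₂ n r → Set
(x , y) ≈ᵤ (x' , y') = (x ≈ᵥ x') × (y ≈ᵥ y')

IsZeroᵤ : {n r : ℕ} → U₂ n r → Set
IsZeroᵤ (x , y) = IsZeroᵥ x × IsZeroᵥ y

Subset : ℕ → ℕ → Set₁
Subset n r = U₂ n r → Set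

_∩_ : {n r : ℕ} → Subset n r → Subset n r → Subset n r
(P ∩ Q) u = P u × Q u

-- A subspace P (over 𝔽₂) is 1-dimensional iff P = {0, u} for some nonzero u.
IsOneDim : {n r : ℕ} → Subset n r → Set
IsOneDim P = ∃ λ u → P u × ¬ IsZeroᵤ u × (∀ w → P w → IsZeroᵤ w ⊎ (w ≈ᵤ u))

IsTrivial : {n r : ℕ} → Subset n r → Set
IsTrivial P = ∀ w → P w → IsZeroᵤ w

-- The split description of a DHO:  given β : 𝔽₂^n → 𝔽₂^{n×r},
-- the members are X(a) = {(x , x β(a)) : x ∈ 𝔽₂^n}, a ∈ 𝔽₂^n.

Member : {n r : ℕ} → (Vec₂ n → Mat₂ n r) → Vec₂ n → Subset n r
Member β a (x , y) = y ≈ᵥ (x ·ᵥₘ β a)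

data InSpan {n r : ℕ} (β : Vec₂ n → Mat₂ n r) : U₂ n r → Set where
  span-mem : ∀ a u → Member β a u → InSpan β u
  span-add : ∀ u w v → InSpan β u → InSpan β w → v ≈ᵤ (u +ᵤ w) → InSpan β v

-- β injective (w.r.t. pointwise equality); then distinct indices ⇔ distinct
-- members, and #𝔻 = 2^n.
Injectiveβ : {n r : ℕ} → (Vec₂ n → Mat₂ n r) → Set
Injectiveβ β = ∀ a b → β a ≈ₘ β b → a ≈ᵥ b

-- β is 𝔽₂-linear (over 𝔽₂ additivity is linearity).
Linearβ : {n r : ℕ} → (Vec₂ n → Mat₂ n r) → Set
Linearβ β = ∀ a b → β (a +ᵥ b) ≈ₘ (β a +ₘ β b)
  where
  _+ₘ_ : Mat₂ _ _ → Mat₂ _ _ → Mat₂ _ _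
  (A +ₘ B) i j = A i j xor B i j

-- 𝔻 = {X(a)} is a DHO of rank n in U = 𝔽₂^n ⊕ 𝔽₂^r (splitting over Y = 0 ⊕ 𝔽₂^r,
-- with fixed member X = X(0)), i.e. #𝔻 = 2^n, two distinct members meet in a
-- 1-dimensional subspace, three distinct members meet in {0}.
IsDHO : {n r : ℕ} → (Vec₂ n → Mat₂ n r) → Set
IsDHO β =
    Injectiveβ β
  × (∀ a b → ¬ (a ≈ᵥ b) → IsOneDim (Member β a ∩ Member β b))
  × (∀ a b c → ¬ (a ≈ᵥ b) → ¬ (a ≈ᵥ c) → ¬ (b ≈ᵥ c)
       → IsTrivial (Member β a ∩ (Member β b ∩ Member β c)))

-- The ambient space (span of all members) is the whole space U, of dimension n+r.
AmbientIsWhole : {n r : ℕ} → (Vec₂ n → Mat₂ n r) → Set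
AmbientIsWhole β = ∀ u → InSpan β u

IsBilinearDHO : {n r : ℕ} → (Vec₂ n → Mat₂ n r) → Set
IsBilinearDHO β = Linearβ β × IsDHO β × AmbientIsWhole β

DHOSet : {n r : ℕ} → (Vec₂ n → Mat₂ n r) → Mat₂ n r → Set
DHOSet β C = ∃ λ a → C ≈ₘ β a

RightNucleus : {n r : ℕ} → (Mat₂ n r → Set) → Mat₂ r r → Set
RightNucleus 𝒞 Y = ∀ C → 𝒞 C → 𝒞 (C ·ₘ Y)

-- For a ≠ 0 the left kernel of β(a) is a line ⟨κ(a)⟩, because X(a) ∩ X(0) is one-dimensional,
-- and distinct nonzero a, b share no nonzero kernel vector, because X(0) ∩ X(a) ∩ X(b) = 0.
-- So κ is an injection from the 2ⁿ − 1 nonzero vectors to themselves, hence a bijection: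
-- every nonzero x spans the kernel of exactly one β(a).
-- If Y lies in the right nucleus and β(a) Y = β(b), then κ(a) is in the kernel of β(b), so
-- b ∈ {0, a}: Y either fixes or kills each β(a). The vectors a with β(a) Y = β(a) and those with
-- β(a) Y = 0 form two subspaces covering 𝔽₂ⁿ and meeting in 0, so one of them is all of 𝔽₂ⁿ.
-- Since the rows x β(a) span 𝔽₂ʳ, Y is then I or 0; conversely I and 0 lie in every nucleus.
module Submission where

open import Defs
open import Data.Nat using (ℕ; zero; suc; _≤_; _<_; _^_; s≤s; z≤n)
import Data.Nat.Properties as ℕ
open import Data.Bool using (Bool; true; false; _xor_; _∧_)
import Data.Bool.Properties as 𝔹
open import Data.Fin using (Fin; _≟_; punchOut; finToFun; funToFin; combine)
  renaming (zero to fzero; suc to fsuc)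
import Data.Fin.Properties as Fin
open import Data.Product using (∃; _×_; _,_; proj₁; proj₂)
open import Data.Sum using (_⊎_; inj₁; inj₂; swap)
open import Data.Empty using (⊥; ⊥-elim)
open import Function using (_∘_)
open import Function.Bundles using (_⇔_; mk⇔; Inverse)
open import Function.Definitions using (Injective)
open import Algebra.Bundles using (CommutativeRing)
open import Relation.Nullary using (¬_; Dec; yes; no; does; contradiction)
open import Relation.Binary.PropositionalEquality
  using (_≡_; refl; sym; trans; cong; cong₂; subst; module ≡-Reasoning)
open import Algebra.Properties.Semiring.Sum
  (CommutativeRing.semiring 𝔹.xor-∧-commutativeRing)
  using (sum; sum-cong-≗; sum-replicate-zero; ∑-distrib-+; ∑-comm; *-distribˡ-sum; *-distribʳ-sum)

open ≡-Reasoning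

xor-cancelʳ : ∀ x y → (x xor y) xor y ≡ x
xor-cancelʳ x y = begin
  (x xor y) xor y ≡⟨ 𝔹.xor-assoc x y y ⟩
  x xor (y xor y) ≡⟨ cong (x xor_) (𝔹.xor-same y) ⟩
  x xor false     ≡⟨ 𝔹.xor-identityʳ x ⟩
  x               ∎

xor-cancelˡ : ∀ x y → x xor (x xor y) ≡ y
xor-cancelˡ x y = trans (sym (𝔹.xor-assoc x x y)) (cong (_xor y) (𝔹.xor-same x))

xor≡false⇒≡ : ∀ {x y} → x xor y ≡ false → x ≡ y
xor≡false⇒≡ {x} {y} x+y≡0 = trans (sym (xor-cancelʳ x y)) (cong (_xor y) x+y≡0)

sum₂≡sum : ∀ {n} (f : Fin n → Bool) → sum₂ f ≡ sum f
sum₂≡sum {zero}  f = refl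
sum₂≡sum {suc n} f = cong (f fzero xor_) (sum₂≡sum (f ∘ fsuc))

sum₂-cong : ∀ {n} {f g : Fin n → Bool} → (∀ i → f i ≡ g i) → sum₂ f ≡ sum₂ g
sum₂-cong {f = f} {g} f≗g =
  trans (sum₂≡sum f) (trans (sum-cong-≗ f≗g) (sym (sum₂≡sum g)))

sum₂-false : ∀ n → sum₂ {n} (λ _ → false) ≡ false
sum₂-false n = trans (sum₂≡sum {n} (λ _ → false)) (sum-replicate-zero n)

sum₂-distrib-xor : ∀ {n} (f g : Fin n → Bool) →
                   sum₂ (λ i → f i xor g i) ≡ sum₂ f xor sum₂ g
sum₂-distrib-xor f g = begin
  sum₂ (λ i → f i xor g i) ≡⟨ sum₂≡sum (λ i → f i xor g i) ⟩
  sum (λ i → f i xor g i)  ≡⟨ ∑-distrib-+ f g ⟩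
  sum f xor sum g          ≡⟨ sym (cong₂ _xor_ (sum₂≡sum f) (sum₂≡sum g)) ⟩
  sum₂ f xor sum₂ g        ∎

∧-distribˡ-sum₂ : ∀ {n} x (f : Fin n → Bool) → x ∧ sum₂ f ≡ sum₂ (λ i → x ∧ f i)
∧-distribˡ-sum₂ x f =
  trans (cong (x ∧_) (sum₂≡sum f)) (trans (*-distribˡ-sum x f) (sym (sum₂≡sum (λ i → x ∧ f i))))

∧-distribʳ-sum₂ : ∀ {n} x (f : Fin n → Bool) → sum₂ f ∧ x ≡ sum₂ (λ i → f i ∧ x)
∧-distribʳ-sum₂ x f =
  trans (cong (_∧ x) (sum₂≡sum f)) (trans (*-distribʳ-sum x f) (sym (sum₂≡sum (λ i → f i ∧ x))))

sum₂-comm : ∀ {m n} (f : Fin m → Fin n → Bool) →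
            sum₂ (λ i → sum₂ (f i)) ≡ sum₂ (λ j → sum₂ (λ i → f i j))
sum₂-comm f = begin
  sum₂ (λ i → sum₂ (f i))           ≡⟨ double (λ i j → f i j) ⟩
  sum (λ i → sum (f i))             ≡⟨ ∑-comm f ⟩
  sum (λ j → sum (λ i → f i j))     ≡⟨ sym (double (λ j i → f i j)) ⟩
  sum₂ (λ j → sum₂ (λ i → f i j))   ∎
  where
  double : ∀ {k l} (g : Fin k → Fin l → Bool) → sum₂ (λ i → sum₂ (g i)) ≡ sum (λ i → sum (g i))
  double g = trans (sum₂≡sum (λ i → sum₂ (g i))) (sum-cong-≗ (λ i → sum₂≡sum (g i)))

sum₂-δˡ : ∀ {n} (k : Fin n) (f : Fin n → Bool) → sum₂ (λ i → does (k ≟ i) ∧ f i) ≡ f k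
sum₂-δˡ {suc n} fzero    f = trans (cong (f fzero xor_) (sum₂-false n)) (𝔹.xor-identityʳ (f fzero))
sum₂-δˡ         (fsuc k) f = sum₂-δˡ k (f ∘ fsuc)

sum₂-δʳ : ∀ {n} (k : Fin n) (f : Fin n → Bool) → sum₂ (λ i → f i ∧ does (i ≟ k)) ≡ f k
sum₂-δʳ {suc n} fzero f = begin
  (f fzero ∧ true) xor sum₂ (λ i → f (fsuc i) ∧ false)
    ≡⟨ cong₂ _xor_ (𝔹.∧-identityʳ (f fzero))
                   (trans (sum₂-cong (𝔹.∧-zeroʳ ∘ f ∘ fsuc)) (sum₂-false n)) ⟩
  f fzero xor false
    ≡⟨ 𝔹.xor-identityʳ (f fzero) ⟩
  f fzero ∎
sum₂-δʳ (fsuc k) f =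
  trans (cong (_xor sum₂ (λ i → f (fsuc i) ∧ does (i ≟ k))) (𝔹.∧-zeroʳ (f fzero)))
        (sum₂-δʳ k (f ∘ fsuc))

0ᵥ : ∀ {n} → Vec₂ n
0ᵥ _ = false

0ₘ : ∀ {n r} → Mat₂ n r
0ₘ _ _ = false

_+ₘ_ : ∀ {n r} → Mat₂ n r → Mat₂ n r → Mat₂ n r
(A +ₘ B) i j = A i j xor B i j

unit : ∀ {n} → Fin n → Vec₂ n
unit j i = does (j ≟ i)

IsZero? : ∀ {n} (x : Vec₂ n) → Dec (IsZeroᵥ x)
IsZero? x = Fin.all? (λ i → x i 𝔹.≟ false)

_≟ᵥ_ : ∀ {n} (x y : Vec₂ n) → Dec (x ≈ᵥ y)
x ≟ᵥ y = Fin.all? (λ i → x i 𝔹.≟ y i)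

≈ᵥ-sym : ∀ {n} {x y : Vec₂ n} → x ≈ᵥ y → y ≈ᵥ x
≈ᵥ-sym x≈y i = sym (x≈y i)

≈ᵥ-trans : ∀ {n} {x y z : Vec₂ n} → x ≈ᵥ y → y ≈ᵥ z → x ≈ᵥ z
≈ᵥ-trans x≈y y≈z i = trans (x≈y i) (y≈z i)

≈ₘ-sym : ∀ {n r} {A B : Mat₂ n r} → A ≈ₘ B → B ≈ₘ A
≈ₘ-sym A≈B i j = sym (A≈B i j)

≈ₘ-trans : ∀ {n r} {A B C : Mat₂ n r} → A ≈ₘ B → B ≈ₘ C → A ≈ₘ C
≈ₘ-trans A≈B B≈C i j = trans (A≈B i j) (B≈C i j)

+ᵥ-identityʳ : ∀ {n} {x z : Vec₂ n} → IsZeroᵥ z → (x +ᵥ z) ≈ᵥ x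
+ᵥ-identityʳ {x = x} z≈0 i = trans (cong (x i xor_) (z≈0 i)) (𝔹.xor-identityʳ (x i))

+ᵥ-self : ∀ {n} {x y : Vec₂ n} → x ≈ᵥ y → IsZeroᵥ (x +ᵥ y)
+ᵥ-self {x = x} x≈y i = trans (cong (x i xor_) (sym (x≈y i))) (𝔹.xor-same (x i))

nonzero-exists : ∀ {n} → 0 < n → ∃ λ (a : Vec₂ n) → ¬ IsZeroᵥ a
nonzero-exists {suc n} _ = (λ _ → true) , λ a≈0 → contradiction (a≈0 fzero) λ ()

module _ {n r : ℕ} where

  ·ᵥₘ-congˡ : ∀ (x : Vec₂ n) {A B : Mat₂ n r} → A ≈ₘ B → (x ·ᵥₘ A) ≈ᵥ (x ·ᵥₘ B)
  ·ᵥₘ-congˡ x A≈B j = sum₂-cong (λ i → cong (x i ∧_) (A≈B i j))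

  ·ᵥₘ-congʳ : ∀ {x y : Vec₂ n} (A : Mat₂ n r) → x ≈ᵥ y → (x ·ᵥₘ A) ≈ᵥ (y ·ᵥₘ A)
  ·ᵥₘ-congʳ A x≈y j = sum₂-cong (λ i → cong (_∧ A i j) (x≈y i))

  ·ᵥₘ-distribˡ-+ : ∀ (x : Vec₂ n) (A B : Mat₂ n r) →
                   (x ·ᵥₘ (A +ₘ B)) ≈ᵥ ((x ·ᵥₘ A) +ᵥ (x ·ᵥₘ B))
  ·ᵥₘ-distribˡ-+ x A B j = trans (sum₂-cong (λ i → 𝔹.∧-distribˡ-xor (x i) (A i j) (B i j)))
                                 (sum₂-distrib-xor (λ i → x i ∧ A i j) (λ i → x i ∧ B i j))

  ·ᵥₘ-distribʳ-+ : ∀ (x y : Vec₂ n) (A : Mat₂ n r) →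
                   ((x +ᵥ y) ·ᵥₘ A) ≈ᵥ ((x ·ᵥₘ A) +ᵥ (y ·ᵥₘ A))
  ·ᵥₘ-distribʳ-+ x y A j = trans (sum₂-cong (λ i → 𝔹.∧-distribʳ-xor (A i j) (x i) (y i)))
                                 (sum₂-distrib-xor (λ i → x i ∧ A i j) (λ i → y i ∧ A i j))

  ·ᵥₘ-zeroˡ : ∀ {x : Vec₂ n} (A : Mat₂ n r) → IsZeroᵥ x → IsZeroᵥ (x ·ᵥₘ A)
  ·ᵥₘ-zeroˡ A x≈0 j = trans (·ᵥₘ-congʳ A x≈0 j) (sum₂-false n)

  ·ᵥₘ-zeroʳ : ∀ (x : Vec₂ n) → IsZeroᵥ (x ·ᵥₘ 0ₘ {n} {r})
  ·ᵥₘ-zeroʳ x j = trans (sum₂-cong (𝔹.∧-zeroʳ ∘ x)) (sum₂-false n)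

  ·ᵥₘ-assoc : ∀ {s} (x : Vec₂ n) (A : Mat₂ n r) (B : Mat₂ r s) →
              ((x ·ᵥₘ A) ·ᵥₘ B) ≈ᵥ (x ·ᵥₘ (A ·ₘ B))
  ·ᵥₘ-assoc x A B k = begin
    sum₂ (λ j → sum₂ (λ i → x i ∧ A i j) ∧ B j k)
      ≡⟨ sum₂-cong (λ j → ∧-distribʳ-sum₂ (B j k) (λ i → x i ∧ A i j)) ⟩
    sum₂ (λ j → sum₂ (λ i → (x i ∧ A i j) ∧ B j k))
      ≡⟨ sum₂-comm (λ j i → (x i ∧ A i j) ∧ B j k) ⟩
    sum₂ (λ i → sum₂ (λ j → (x i ∧ A i j) ∧ B j k))
      ≡⟨ sum₂-cong (λ i → sum₂-cong (λ j → 𝔹.∧-assoc (x i) (A i j) (B j k))) ⟩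
    sum₂ (λ i → sum₂ (λ j → x i ∧ (A i j ∧ B j k)))
      ≡⟨ sum₂-cong (λ i → sym (∧-distribˡ-sum₂ (x i) (λ j → A i j ∧ B j k))) ⟩
    sum₂ (λ i → x i ∧ sum₂ (λ j → A i j ∧ B j k))
      ∎

  unit-·ᵥₘ : ∀ (j : Fin n) (A : Mat₂ n r) → (unit j ·ᵥₘ A) ≈ᵥ A j
  unit-·ᵥₘ j A k = sum₂-δˡ j (λ i → A i k)

  ≈ₘ-from-·ᵥₘ : ∀ {A B : Mat₂ n r} → (∀ x → (x ·ᵥₘ A) ≈ᵥ (x ·ᵥₘ B)) → A ≈ₘ B
  ≈ₘ-from-·ᵥₘ {A} {B} xA≈xB j k = begin
    A j k              ≡⟨ sym (unit-·ᵥₘ j A k) ⟩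
    (unit j ·ᵥₘ A) k   ≡⟨ xA≈xB (unit j) k ⟩
    (unit j ·ᵥₘ B) k   ≡⟨ unit-·ᵥₘ j B k ⟩
    B j k              ∎

-- (A ·ₘ B) i is definitionally A i ·ᵥₘ B.
module _ {n r s : ℕ} where

  ·ₘ-congˡ : ∀ (A : Mat₂ n r) {B C : Mat₂ r s} → B ≈ₘ C → (A ·ₘ B) ≈ₘ (A ·ₘ C)
  ·ₘ-congˡ A B≈C i = ·ᵥₘ-congˡ (A i) B≈C

  ·ₘ-congʳ : ∀ {A B : Mat₂ n r} (C : Mat₂ r s) → A ≈ₘ B → (A ·ₘ C) ≈ₘ (B ·ₘ C)
  ·ₘ-congʳ C A≈B i = ·ᵥₘ-congʳ C (A≈B i)

  ·ₘ-distribʳ-+ : ∀ (A B : Mat₂ n r) (C : Mat₂ r s) → ((A +ₘ B) ·ₘ C) ≈ₘ ((A ·ₘ C) +ₘ (B ·ₘ C))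
  ·ₘ-distribʳ-+ A B C i = ·ᵥₘ-distribʳ-+ (A i) (B i) C

  ·ₘ-zeroˡ : ∀ (B : Mat₂ r s) → (0ₘ {n} ·ₘ B) ≈ₘ 0ₘ
  ·ₘ-zeroˡ B i = ·ᵥₘ-zeroˡ B (λ _ → refl)

  ·ₘ-zeroʳ : ∀ (A : Mat₂ n r) → (A ·ₘ 0ₘ {r} {s}) ≈ₘ 0ₘ
  ·ₘ-zeroʳ A i = ·ᵥₘ-zeroʳ (A i)

·ₘ-identityʳ : ∀ {n r} (A : Mat₂ n r) → (A ·ₘ scalarMat r true) ≈ₘ A
·ₘ-identityʳ A i k = sum₂-δʳ k (A i)

-- Coding 𝔽₂ⁿ by Fin (2 ^ n)

module _ {n : ℕ} where

  open Inverse Fin.2↔Bool using (to; from; strictlyInverseˡ; strictlyInverseʳ)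

  encode : Vec₂ n → Fin (2 ^ n)
  encode x = funToFin (from ∘ x)

  decode : Fin (2 ^ n) → Vec₂ n
  decode k = to ∘ finToFun k

  decode-encode : ∀ x → decode (encode x) ≈ᵥ x
  decode-encode x i = trans (cong to (Fin.finToFun-funToFin (from ∘ x) i)) (strictlyInverseˡ (x i))

  encode-injective : ∀ {x y} → encode x ≡ encode y → x ≈ᵥ y
  encode-injective {x} {y} eq =
    ≈ᵥ-trans (≈ᵥ-sym (decode-encode x)) (≈ᵥ-trans (λ i → cong (λ k → decode k i) eq) (decode-encode y))

  decode-injective : ∀ {k l} → decode k ≈ᵥ decode l → k ≡ l
  decode-injective {k} {l} dk≈dl = begin
    k                          ≡⟨ sym (Fin.funToFin-finToFin {n} k) ⟩
    funToFin {n} (finToFun k)  ≡⟨ funToFin-cong (λ i → trans (sym (strictlyInverseʳ _))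
                                                       (trans (cong from (dk≈dl i)) (strictlyInverseʳ _))) ⟩
    funToFin {n} (finToFun l)  ≡⟨ Fin.funToFin-finToFin {n} l ⟩
    l                          ∎
    where
    funToFin-cong : ∀ {m} {f g : Fin m → Fin 2} → (∀ i → f i ≡ g i) → funToFin f ≡ funToFin g
    funToFin-cong {zero}  f≗g = refl
    funToFin-cong {suc m} f≗g = cong₂ combine (f≗g fzero) (funToFin-cong (f≗g ∘ fsuc))

Fin-injective⇒surjective : ∀ {m} {f : Fin m → Fin m} → Injective _≡_ _≡_ f → ∀ t → ∃ λ i → f i ≡ t
Fin-injective⇒surjective {suc m} {f} f-inj t with Fin.any? (λ i → f i ≟ t)
... | yes hit = hit
... | no ¬hit = contradiction (Fin.injective⇒≤ g-inj) ℕ.1+n≰n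
  where
  f≢t : ∀ i → ¬ t ≡ f i
  f≢t i t≡fi = ¬hit (i , sym t≡fi)
  g : Fin (suc m) → Fin m
  g i = punchOut (f≢t i)
  g-inj : Injective _≡_ _≡_ g
  g-inj {i} {j} = f-inj ∘ Fin.punchOut-injective (f≢t i) (f≢t j)

-- Subspaces of 𝔽₂ⁿ

ClosedUnder+ : ∀ {n} → (Vec₂ n → Set) → Set
ClosedUnder+ S = ∀ {a b c} → c ≈ᵥ (a +ᵥ b) → S a → S b → S c

module _ {n : ℕ} {S T : Vec₂ n → Set} (S+ : ClosedUnder+ S) (T+ : ClosedUnder+ T)
         (S∪T : ∀ a → S a ⊎ T a) (S∩T : ∀ {a} → S a → T a → IsZeroᵥ a) where

  covering-subspace-is-everything : ∀ {a₀} → ¬ IsZeroᵥ a₀ → S a₀ → ∀ a → S a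
  covering-subspace-is-everything {a₀} a₀≢0 Sa₀ a with S∪T a | S∪T (a +ᵥ a₀)
  ... | inj₁ Sa | _       = Sa
  ... | inj₂ _  | inj₁ Sb = S+ (λ i → sym (xor-cancelʳ (a i) (a₀ i))) Sb Sa₀
  ... | inj₂ Ta | inj₂ Tb = contradiction (S∩T Sa₀ (T+ (λ i → sym (xor-cancelˡ (a i) (a₀ i))) Ta Tb)) a₀≢0

union-of-subspaces : ∀ {n} {S T : Vec₂ n → Set} → ClosedUnder+ S → ClosedUnder+ T →
                     (∀ a → S a ⊎ T a) → (∀ {a} → S a → T a → IsZeroᵥ a) →
                     0 < n → (∀ a → S a) ⊎ (∀ a → T a)
union-of-subspaces S+ T+ S∪T S∩T 0<n with nonzero-exists 0<n
... | a₀ , a₀≢0 with S∪T a₀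
...   | inj₁ Sa₀ = inj₁ (covering-subspace-is-everything S+ T+ S∪T S∩T a₀≢0 Sa₀)
...   | inj₂ Ta₀ = inj₂ (covering-subspace-is-everything T+ S+ (swap ∘ S∪T) (λ Ta Sa → S∩T Sa Ta) a₀≢0 Ta₀)

-- Kernels of a bilinear dual hyperoval

_∈ker_ : ∀ {n r} → Vec₂ n → Mat₂ n r → Set
x ∈ker M = IsZeroᵥ (x ·ᵥₘ M)

∈ker-resp : ∀ {n r} {x y : Vec₂ n} (M : Mat₂ n r) → x ≈ᵥ y → x ∈ker M → y ∈ker M
∈ker-resp M x≈y x∈kerM = ≈ᵥ-trans (·ᵥₘ-congʳ M (≈ᵥ-sym x≈y)) x∈kerM

∈ker-cong : ∀ {n r} {x : Vec₂ n} {A B : Mat₂ n r} → A ≈ₘ B → x ∈ker A → x ∈ker B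
∈ker-cong {x = x} A≈B x∈kerA = ≈ᵥ-trans (·ᵥₘ-congˡ x (≈ₘ-sym A≈B)) x∈kerA

∈ker-·ₘ : ∀ {n r s} {x : Vec₂ n} {A : Mat₂ n r} (B : Mat₂ r s) → x ∈ker A → x ∈ker (A ·ₘ B)
∈ker-·ₘ {x = x} {A} B x∈kerA = ≈ᵥ-trans (≈ᵥ-sym (·ᵥₘ-assoc x A B)) (·ᵥₘ-zeroˡ B x∈kerA)

β-zero : ∀ {n r} (β : Vec₂ n → Mat₂ n r) → Linearβ β → β 0ᵥ ≈ₘ 0ₘ
β-zero β lin i j = trans (lin 0ᵥ 0ᵥ i j) (𝔹.xor-same (β 0ᵥ i j))

scalarMat-∈-nucleus : ∀ {n r} {β : Vec₂ n → Mat₂ n r} → Linearβ β →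
                      ∀ {Y} c → Y ≈ₘ scalarMat r c → RightNucleus (DHOSet β) Y
scalarMat-∈-nucleus lin true Y≈I C (a , C≈βa) =
  a , ≈ₘ-trans (·ₘ-congˡ C Y≈I) (≈ₘ-trans (·ₘ-identityʳ C) C≈βa)
scalarMat-∈-nucleus {β = β} lin false Y≈0 C _ =
  0ᵥ , ≈ₘ-trans (·ₘ-congˡ C Y≈0) (≈ₘ-trans (·ₘ-zeroʳ C) (≈ₘ-sym (β-zero β lin)))

module BilinearDHO {n r : ℕ} (β : Vec₂ n → Mat₂ n r) (lin : Linearβ β) (dho : IsDHO β) where

  private
    β-injective = proj₁ dho
    meet₂ = proj₁ (proj₂ dho)
    meet₃ = proj₂ (proj₂ dho)

  ∈ker-β0 : ∀ x → x ∈ker β 0ᵥ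
  ∈ker-β0 x = ≈ᵥ-trans (·ᵥₘ-congˡ x (β-zero β lin)) (·ᵥₘ-zeroʳ x)

  ∈ker⇒∈X∩X₀ : ∀ {a x} → x ∈ker β a → (Member β a ∩ Member β 0ᵥ) (x , 0ᵥ)
  ∈ker⇒∈X∩X₀ {x = x} x∈ker = ≈ᵥ-sym x∈ker , ≈ᵥ-sym (∈ker-β0 x)

  kernel-nontrivial : ∀ {a} → ¬ IsZeroᵥ a → ∃ λ x → ¬ IsZeroᵥ x × x ∈ker β a
  kernel-nontrivial {a} a≢0 with meet₂ a 0ᵥ a≢0
  ... | (x , y) , (y≈xβa , y≈xβ0) , u≢0 , _ =
    x , (λ x≈0 → u≢0 (x≈0 , y≈0)) , ≈ᵥ-trans (≈ᵥ-sym y≈xβa) y≈0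
    where
    y≈0 : IsZeroᵥ y
    y≈0 = ≈ᵥ-trans y≈xβ0 (∈ker-β0 x)

  kernel-nonzero-unique : ∀ {a x y} → ¬ IsZeroᵥ a → ¬ IsZeroᵥ x → ¬ IsZeroᵥ y →
                          x ∈ker β a → y ∈ker β a → x ≈ᵥ y
  kernel-nonzero-unique {a} a≢0 x≢0 y≢0 x∈ker y∈ker with meet₂ a 0ᵥ a≢0
  ... | _ , _ , _ , on-line with on-line _ (∈ker⇒∈X∩X₀ x∈ker) | on-line _ (∈ker⇒∈X∩X₀ y∈ker)
  ...   | inj₁ (x≈0 , _) | _              = contradiction x≈0 x≢0
  ...   | inj₂ _         | inj₁ (y≈0 , _) = contradiction y≈0 y≢0
  ...   | inj₂ (x≈u , _) | inj₂ (y≈u , _) = ≈ᵥ-trans x≈u (≈ᵥ-sym y≈u)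

  kernels-disjoint : ∀ {a b x} → ¬ IsZeroᵥ a → ¬ IsZeroᵥ b → ¬ a ≈ᵥ b → ¬ IsZeroᵥ x →
                     x ∈ker β a → x ∈ker β b → ⊥
  kernels-disjoint {a} {b} {x} a≢0 b≢0 a≢b x≢0 x∈kerβa x∈kerβb =
    x≢0 (proj₁ (meet₃ 0ᵥ a b (a≢0 ∘ ≈ᵥ-sym) (b≢0 ∘ ≈ᵥ-sym) a≢b (x , 0ᵥ)
      (≈ᵥ-sym (∈ker-β0 x) , ≈ᵥ-sym x∈kerβa , ≈ᵥ-sym x∈kerβb)))

  kernel-determines-index : ∀ {a b x} → ¬ IsZeroᵥ a → ¬ IsZeroᵥ x →
                            x ∈ker β a → x ∈ker β b → IsZeroᵥ b ⊎ b ≈ᵥ a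
  kernel-determines-index {a} {b} a≢0 x≢0 x∈kerβa x∈kerβb with IsZero? b | b ≟ᵥ a
  ... | yes b≈0 | _       = inj₁ b≈0
  ... | no _    | yes b≈a = inj₂ b≈a
  ... | no b≢0  | no b≢a  = ⊥-elim (kernels-disjoint a≢0 b≢0 (b≢a ∘ ≈ᵥ-sym) x≢0 x∈kerβa x∈kerβb)

  -- κ(0) = 0 makes κ an injection of the whole space, so that counting applies.
  kernelVector : Vec₂ n → Vec₂ n
  kernelVector a with IsZero? a
  ... | yes _  = 0ᵥ
  ... | no a≢0 = proj₁ (kernel-nontrivial a≢0)

  kernelVector-zero : ∀ {a} → IsZeroᵥ a → IsZeroᵥ (kernelVector a)
  kernelVector-zero {a} a≈0 with IsZero? a
  ... | yes _  = λ _ → refl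
  ... | no a≢0 = contradiction a≈0 a≢0

  kernelVector-nonzero : ∀ {a} → ¬ IsZeroᵥ a → ¬ IsZeroᵥ (kernelVector a) × kernelVector a ∈ker β a
  kernelVector-nonzero {a} a≢0 with IsZero? a
  ... | yes a≈0 = contradiction a≈0 a≢0
  ... | no a≢0′ = proj₂ (kernel-nontrivial a≢0′)

  kernelVector-injective : ∀ {a b} → kernelVector a ≈ᵥ kernelVector b → a ≈ᵥ b
  kernelVector-injective {a} {b} κa≈κb = by-cases (IsZero? a) (IsZero? b)
    where
    by-cases : Dec (IsZeroᵥ a) → Dec (IsZeroᵥ b) → a ≈ᵥ b
    by-cases (yes a≈0) (yes b≈0) = ≈ᵥ-trans a≈0 (≈ᵥ-sym b≈0)
    by-cases (yes a≈0) (no b≢0)  =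
      contradiction (≈ᵥ-trans (≈ᵥ-sym κa≈κb) (kernelVector-zero a≈0)) (proj₁ (kernelVector-nonzero b≢0))
    by-cases (no a≢0)  (yes b≈0) =
      contradiction (≈ᵥ-trans κa≈κb (kernelVector-zero b≈0)) (proj₁ (kernelVector-nonzero a≢0))
    by-cases (no a≢0)  (no b≢0)
      with κb≢0 , κb∈kerβb ← kernelVector-nonzero b≢0
      with kernel-determines-index b≢0 κb≢0 κb∈kerβb
             (∈ker-resp (β a) κa≈κb (proj₂ (kernelVector-nonzero a≢0)))
    ... | inj₁ a≈0 = contradiction a≈0 a≢0
    ... | inj₂ a≈b = a≈b

  kernelCode : Fin (2 ^ n) → Fin (2 ^ n)
  kernelCode = encode ∘ kernelVector ∘ decode

  kernelCode-injective : Injective _≡_ _≡_ kernelCode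
  kernelCode-injective = decode-injective ∘ kernelVector-injective ∘ encode-injective

  kernels-cover : ∀ {x} → ¬ IsZeroᵥ x → ∃ λ k → ¬ IsZeroᵥ (decode k) × x ∈ker β (decode k)
  kernels-cover {x} x≢0 with k , κk≡x ← Fin-injective⇒surjective kernelCode-injective (encode x)
    with κ≈x ← encode-injective κk≡x
    with IsZero? (decode k)
  ... | yes a≈0 = contradiction (≈ᵥ-trans (≈ᵥ-sym κ≈x) (kernelVector-zero a≈0)) x≢0
  ... | no a≢0  = k , a≢0 , ∈ker-resp (β (decode k)) κ≈x (proj₂ (kernelVector-nonzero a≢0))

  -- β is an arbitrary function on Fin n → Bool, so a priori it need not respect ≈ᵥ. It does on
  -- codes, as decode is injective up to ≈ᵥ; and for z ≈ 0 because a + z ≈ a shares the kernel of a.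
  ∈ker-transport : ∀ {c k x} → ¬ IsZeroᵥ c → c ≈ᵥ decode k → x ∈ker β c → x ∈ker β (decode k)
  ∈ker-transport {k = k} {x} c≢0 c≈a x∈kerβc with IsZero? x
  ... | yes x≈0 = ·ᵥₘ-zeroˡ (β (decode k)) x≈0
  ... | no x≢0
    with l , b≢0 , x∈kerβb ← kernels-cover x≢0
    with kernel-determines-index c≢0 x≢0 x∈kerβc x∈kerβb
  ...   | inj₁ b≈0 = contradiction b≈0 b≢0
  ...   | inj₂ b≈c = subst (λ m → x ∈ker β (decode m)) (decode-injective (≈ᵥ-trans b≈c c≈a)) x∈kerβb

  ∈ker-cancel : ∀ {a z x} → x ∈ker β a → x ∈ker β (a +ᵥ z) → x ∈ker β z
  ∈ker-cancel {a} {z} {x} x∈kerβa x∈kerβa+z j = begin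
    (x ·ᵥₘ β z) j                          ≡⟨ cong (_xor (x ·ᵥₘ β z) j) (sym (x∈kerβa j)) ⟩
    (x ·ᵥₘ β a) j xor (x ·ᵥₘ β z) j        ≡⟨ sym (·ᵥₘ-distribˡ-+ x (β a) (β z) j) ⟩
    (x ·ᵥₘ (β a +ₘ β z)) j                 ≡⟨ sym (·ᵥₘ-congˡ x (lin a z) j) ⟩
    (x ·ᵥₘ β (a +ᵥ z)) j                   ≡⟨ x∈kerβa+z j ⟩
    false                                  ∎

  ∈ker-β-zero : ∀ {z} → IsZeroᵥ z → ∀ x → x ∈ker β z
  ∈ker-β-zero {z} z≈0 x with IsZero? x
  ... | yes x≈0 = ·ᵥₘ-zeroˡ (β z) x≈0
  ... | no x≢0 with k , a≢0 , x∈kerβa ← kernels-cover x≢0 =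
    let c≈a                  = +ᵥ-identityʳ {x = decode k} z≈0
        c≢0                  = a≢0 ∘ ≈ᵥ-trans (≈ᵥ-sym c≈a)
        x′ , x′≢0 , x′∈kerβc = kernel-nontrivial c≢0
        x′≈x                 = kernel-nonzero-unique a≢0 x′≢0 x≢0 (∈ker-transport c≢0 c≈a x′∈kerβc) x∈kerβa
    in ∈ker-cancel x∈kerβa (∈ker-resp (β (decode k +ᵥ z)) x′≈x x′∈kerβc)

  β-zero-cong : ∀ {z} → IsZeroᵥ z → β z ≈ₘ 0ₘ
  β-zero-cong z≈0 = ≈ₘ-from-·ᵥₘ λ x → ≈ᵥ-trans (∈ker-β-zero z≈0 x) (≈ᵥ-sym (·ᵥₘ-zeroʳ x))

  β-cong : ∀ {a b} → a ≈ᵥ b → β a ≈ₘ β b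
  β-cong {a} {b} a≈b i j =
    xor≡false⇒≡ (trans (sym (lin a b i j)) (β-zero-cong (+ᵥ-self a≈b) i j))

  Agree : Mat₂ r r → Mat₂ r r → Vec₂ n → Set
  Agree Y Z a = (β a ·ₘ Y) ≈ₘ (β a ·ₘ Z)

  agree-closed : ∀ Y Z → ClosedUnder+ (Agree Y Z)
  agree-closed Y Z {a} {b} {c} c≈a+b aY≈aZ bY≈bZ i k = begin
    (β c ·ₘ Y) i k                             ≡⟨ ·ₘ-congʳ Y βc≈βa+βb i k ⟩
    ((β a +ₘ β b) ·ₘ Y) i k                    ≡⟨ ·ₘ-distribʳ-+ (β a) (β b) Y i k ⟩
    (β a ·ₘ Y) i k xor (β b ·ₘ Y) i k          ≡⟨ cong₂ _xor_ (aY≈aZ i k) (bY≈bZ i k) ⟩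
    (β a ·ₘ Z) i k xor (β b ·ₘ Z) i k          ≡⟨ sym (·ₘ-distribʳ-+ (β a) (β b) Z i k) ⟩
    ((β a +ₘ β b) ·ₘ Z) i k                    ≡⟨ sym (·ₘ-congʳ Z βc≈βa+βb i k) ⟩
    (β c ·ₘ Z) i k                             ∎
    where
    βc≈βa+βb : β c ≈ₘ (β a +ₘ β b)
    βc≈βa+βb = ≈ₘ-trans (β-cong c≈a+b) (lin a b)

  fixed-and-killed⇒zero : ∀ {Y a} → Agree Y (scalarMat r true) a → Agree Y (scalarMat r false) a → IsZeroᵥ a
  fixed-and-killed⇒zero {Y} {a} fixed killed = β-injective a 0ᵥ λ i k → begin
    β a i k                           ≡⟨ sym (·ₘ-identityʳ (β a) i k) ⟩
    (β a ·ₘ scalarMat r true) i k     ≡⟨ sym (fixed i k) ⟩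
    (β a ·ₘ Y) i k                    ≡⟨ killed i k ⟩
    (β a ·ₘ 0ₘ) i k                   ≡⟨ ·ₘ-zeroʳ (β a) i k ⟩
    false                             ≡⟨ sym (β-zero β lin i k) ⟩
    β 0ᵥ i k                          ∎

  nucleus-fixes-or-kills : ∀ {Y} → RightNucleus (DHOSet β) Y →
                           ∀ a → Agree Y (scalarMat r true) a ⊎ Agree Y (scalarMat r false) a
  nucleus-fixes-or-kills {Y} nucleus a with IsZero? a
  ... | yes a≈0 =
    inj₂ (≈ₘ-trans (≈ₘ-trans (·ₘ-congʳ Y (β-zero-cong a≈0)) (·ₘ-zeroˡ Y)) (≈ₘ-sym (·ₘ-zeroʳ (β a))))
  ... | no a≢0
    with b , βaY≈βb ← nucleus (β a) (a , λ _ _ → refl)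
    with x , x≢0 , x∈kerβa ← kernel-nontrivial a≢0
    with kernel-determines-index a≢0 x≢0 x∈kerβa (∈ker-cong βaY≈βb (∈ker-·ₘ {A = β a} Y x∈kerβa))
  ...   | inj₁ b≈0 =
    inj₂ (≈ₘ-trans βaY≈βb (≈ₘ-trans (β-zero-cong b≈0) (≈ₘ-sym (·ₘ-zeroʳ (β a)))))
  ...   | inj₂ b≈a =
    inj₁ (≈ₘ-trans βaY≈βb (≈ₘ-trans (β-cong b≈a) (≈ₘ-sym (·ₘ-identityʳ (β a)))))

  agree-on-span : ∀ {Y Z} → (∀ a → Agree Y Z a) → ∀ {u} → InSpan β u → (proj₂ u ·ᵥₘ Y) ≈ᵥ (proj₂ u ·ᵥₘ Z)
  agree-on-span {Y} {Z} agree (span-mem a (x , y) y≈xβa) k = begin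
    (y ·ᵥₘ Y) k               ≡⟨ ·ᵥₘ-congʳ Y y≈xβa k ⟩
    ((x ·ᵥₘ β a) ·ᵥₘ Y) k     ≡⟨ ·ᵥₘ-assoc x (β a) Y k ⟩
    (x ·ᵥₘ (β a ·ₘ Y)) k      ≡⟨ ·ᵥₘ-congˡ x (agree a) k ⟩
    (x ·ᵥₘ (β a ·ₘ Z)) k      ≡⟨ sym (·ᵥₘ-assoc x (β a) Z k) ⟩
    ((x ·ᵥₘ β a) ·ᵥₘ Z) k     ≡⟨ sym (·ᵥₘ-congʳ Z y≈xβa k) ⟩
    (y ·ᵥₘ Z) k               ∎
  agree-on-span {Y} {Z} agree (span-add (_ , y₁) (_ , y₂) (_ , y) s₁ s₂ (_ , y≈y₁+y₂)) k = begin
    (y ·ᵥₘ Y) k                            ≡⟨ ·ᵥₘ-congʳ Y y≈y₁+y₂ k ⟩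
    ((y₁ +ᵥ y₂) ·ᵥₘ Y) k                   ≡⟨ ·ᵥₘ-distribʳ-+ y₁ y₂ Y k ⟩
    (y₁ ·ᵥₘ Y) k xor (y₂ ·ᵥₘ Y) k          ≡⟨ cong₂ _xor_ (agree-on-span agree s₁ k) (agree-on-span agree s₂ k) ⟩
    (y₁ ·ᵥₘ Z) k xor (y₂ ·ᵥₘ Z) k          ≡⟨ sym (·ᵥₘ-distribʳ-+ y₁ y₂ Z k) ⟩
    ((y₁ +ᵥ y₂) ·ᵥₘ Z) k                   ≡⟨ sym (·ᵥₘ-congʳ Z y≈y₁+y₂ k) ⟩
    (y ·ᵥₘ Z) k                            ∎

  agree-everywhere⇒≈ : ∀ {Y Z} → AmbientIsWhole β → (∀ a → Agree Y Z a) → Y ≈ₘ Z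
  agree-everywhere⇒≈ whole agree = ≈ₘ-from-·ᵥₘ λ y → agree-on-span agree (whole (0ᵥ , y))

  nucleus-is-scalar : 0 < n → AmbientIsWhole β → ∀ {Y} → RightNucleus (DHOSet β) Y →
                      ∃ λ c → Y ≈ₘ scalarMat r c
  nucleus-is-scalar 0<n whole {Y} nucleus
    with union-of-subspaces (agree-closed Y _) (agree-closed Y _) (nucleus-fixes-or-kills nucleus)
                            fixed-and-killed⇒zero 0<n
  ... | inj₁ fixes = true  , agree-everywhere⇒≈ whole fixes
  ... | inj₂ kills = false , agree-everywhere⇒≈ whole kills

corollary6p7 : (n r : ℕ) → 2 ≤ n → (β : Vec₂ n → Mat₂ n r) → IsBilinearDHO β →
    (Y : Mat₂ r r) → RightNucleus (DHOSet β) Y ⇔ (∃ λ c → Y ≈ₘ scalarMat r c)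
corollary6p7 n r 2≤n β (lin , dho , whole) Y =
  mk⇔ (BilinearDHO.nucleus-is-scalar β lin dho (ℕ.<-trans (s≤s z≤n) 2≤n) whole)
      (λ (c , Y≈cI) → scalarMat-∈-nucleus lin c Y≈cI)
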